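{- Let $n \ge 1$ and $d \ge 2$ be integers, and let $\mathcal{F} = \{(A_i^{(1)}, \dots, A_i^{(d)}) \mid i \in [m]\}$ be a Bollobás system of $d$-tuples with $A_i^{(p)} \subseteq [n]$ for all $i \in [m]$, $p \in [d]$. Then: (1) if $d = 3$, $$\sum_{i=1}^m \binom{|A_i^{(1)}| + |A_i^{(2)}| + |A_i^{(3)}|}{|A_i^{(1)}|, |A_i^{(2)}|, |A_i^{(3)}|}^{ -1} \le \frac{n+3}{2};$$ (2) for every fixed $d$, as $n \to \infty$, $$\sum_{i=1}^m \binom{|A_i^{(1)}| + \cdots + |A_i^{(d)}|}{|A_i^{(1)}|, \dots, |A_i^{(d)}|}^{ -1} \le \frac{1}{d-1}\binom{n+d-2}{d-2} + O(n^{d-3}),$$ i.e. there exist constants $C_d, N_d$ depending only on $d$ such that for all $n \ge N_d$ and every such Bollobás system with ground set $[n]$, the left-hand side is at most $\frac{1}{d-1}\binom{n+d-2}{d-2} + C_d n^{d-3}$.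
   Context: $[n] = \{1,\dots,n\}$. For nonnegative integers $a_1,\dots,a_d$, $\binom{a_1+\cdots+a_d}{a_1,\dots,a_d} = \frac{(a_1+\cdots+a_d)!}{a_1!\cdots a_d!}$ is the multinomial coefficient. A family $\mathcal{F} = \{(A_i^{(1)}, \dots, A_i^{(d)}) \mid i \in [m]\}$ of $d$-tuples of finite sets is a Bollobás system of $d$-tuples if $A_i^{(p)} \cap A_i^{(q)} = \emptyset$ for every $i \in [m]$ and $p \ne q$, and for any $i \ne j$ in $[m]$ there exist $p < q$ in $[d]$ with $A_i^{(p)} \cap A_j^{(q)} \ne \emptyset$. -}

module Defs where

open import Data.Nat as ℕ using (ℕ; zero; suc; _!; _∸_; _^_)
open import Data.Nat.Properties using (_!≢0; m^n≢0)
open import Data.Nat.Combinatorics using (_C_)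
open import Data.Integer using (+_)
open import Data.Rational as ℚ using (ℚ; _/_; 0ℚ)
open import Data.Fin using (Fin; zero; suc; _<_)
open import Data.Fin.Subset using (Subset; _∩_; Nonempty; Empty; ∣_∣)
open import Data.Product using (_×_; Σ; ∃)
open import Relation.Nullary using (¬_)
open import Relation.Binary.PropositionalEquality using (_≡_)

sumℚ : ∀ {m} → (Fin m → ℚ) → ℚ
sumℚ {zero}  f = 0ℚ
sumℚ {suc m} f = f zero ℚ.+ sumℚ (λ i → f (suc i))

sumℕ : ∀ {d} → (Fin d → ℕ) → ℕ
sumℕ {zero}  f = 0
sumℕ {suc d} f = f zero ℕ.+ sumℕ (λ i → f (suc i))

prodℕ : ∀ {d} → (Fin d → ℕ) → ℕ
prodℕ {zero}  f = 1
prodℕ {suc d} f = f zero ℕ.* prodℕ (λ i → f (suc i))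

multinomial⁻¹ : ∀ {d} → (Fin d → ℕ) → ℚ
multinomial⁻¹ a = _/_ (+ prodℕ (λ p → a p !)) (sumℕ a !) {{sumℕ a !≢0}}

-- a family of m d-tuples of subsets of [n]:  F i p = A_i^{(p)}
Family : ℕ → ℕ → ℕ → Set
Family m d n = Fin m → Fin d → Subset n

IsBollobas : ∀ {m d n} → Family m d n → Set
IsBollobas {m} {d} F =
  (∀ (i : Fin m) (p q : Fin d) → ¬ (p ≡ q) → Empty (F i p ∩ F i q)) ×
  (∀ (i j : Fin m) → ¬ (i ≡ j) →
     Σ (Fin d) λ p → Σ (Fin d) λ q → (p < q) × Nonempty (F i p ∩ F j q))

lubellSum : ∀ {m d n} → Family m d n → ℚ
lubellSum F = sumℚ (λ i → multinomial⁻¹ (λ p → ∣ F i p ∣))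

-- n^(d-3) as a rational (for d = 2 this is 1/n; n = 0 is never used)
powd-3 : ℕ → ℕ → ℚ
powd-3 zero    d = 0ℚ
powd-3 (suc k) d = _/_ (+ (suc k ^ (d ∸ 3))) (suc k ^ (3 ∸ d)) {{m^n≢0 (suc k) (3 ∸ d)}}

mainTerm : ℕ → ℕ → ℚ
mainTerm n d = (+ ((n ℕ.+ d ∸ 2) C (d ∸ 2))) / suc (d ∸ 2)

-- Order the ground set uniformly at random; a tuple (A¹, …, Aᵈ) is compatible with the order if A¹
-- entirely precedes A², which entirely precedes A³, and so on. This has probability equal to the
-- inverse multinomial coefficient, so the Lubell sum is the expected number of compatible tuples.
-- For a fixed order, a compatible tuple has the monotone cut vector c₁ ≤ … ≤ c_{d−1} in [0, n], where
-- cₚ is the position of the last point of A¹ ∪ … ∪ Aᵖ, and the Bollobás condition makes the cut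
-- vectors of two compatible tuples incomparable. Deleting one entry of a cut vector (or, at a plateau
-- cⱼ = cⱼ₊₁, both entries while remembering j) gives d − 1 codes per tuple, pairwise distinct over an
-- antichain. As there are C(n+d−2, d−2) + (d−2)·C(n+d−3, d−3) codes, at most a (d−1)-th of that many
-- tuples are compatible with any order; for d = 3 this is (n + 2)/2.
-- The average over orders is computed by choosing the last point first, recursively, and the cut
-- vectors are recorded along this recursion.

{-# OPTIONS --safe #-}
module Submission where

open import Defs
open import Data.Nat using (ℕ; _≤_; _≥_; _+_)
open import Data.Integer using (+_)
open import Data.Rational as ℚ using (ℚ; _/_)
open import Data.Product using (_×_; Σ)

open import Data.Bool using (true; false; if_then_else_)
open import Data.Empty using (⊥; ⊥-elim)
open import Data.Fin as Fin
  using (Fin; zero; suc; toℕ; fromℕ<; punchIn; punchOut; _↑ˡ_; _↑ʳ_; splitAt; join; combine; remQuot)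
open import Data.Fin.Properties
  using (toℕ-injective; toℕ<n; punchInᵢ≢i; punchIn-punchOut; any?; all?; injective⇒≤; ↑ˡ-injective; ↑ʳ-injective;
         splitAt-↑ˡ; splitAt-↑ʳ; splitAt-join; combine-injective; combine-remQuot; fromℕ<-injective)
open import Data.Fin.Subset using (Subset; _∈_; _∩_; ∣_∣)
open import Data.Fin.Subset.Properties using (_∈?_; x∈p∩q⁺; x∈p∩q⁻)
import Data.Integer as ℤ
import Data.Integer.Properties as ℤ
open import Data.List as List using (List; []; _∷_; length; lookup; filter; tabulate)
open import Data.List.Membership.Propositional.Properties using (∈-lookup)
open import Data.List.Properties using (length-map; map-tabulate)
open import Data.List.Relation.Unary.All as All using (All; []; _∷_)
import Data.List.Relation.Unary.All.Properties as All
open import Data.List.Relation.Unary.AllPairs as AllPairs using (AllPairs; []; _∷_)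
import Data.List.Relation.Unary.AllPairs.Properties as AllPairs
open import Data.Maybe using (Maybe; just; nothing)
import Data.Maybe.Relation.Unary.All as Maybe
open import Data.Nat hiding (_/_)
import Data.Nat.ListAction as ℕ
open import Data.Nat.Combinatorics using (_C_; nCn≡1; nCk+nC[k+1]≡[n+1]C[k+1])
open import Data.Nat.Properties
open import Data.Nat.Tactic.RingSolver using (solve-∀)
open import Algebra.Properties.Semiring.Sum +-*-semiring
  using (sum; sum-syntax; sum-cong-≗; sum-remove; sum-replicate-zero; ∑-comm; ∑-distrib-+;
         *-distribˡ-sum; *-distribʳ-sum)
import Algebra.Properties.CommutativeMonoid.Sum *-1-commutativeMonoid as Π
import Algebra.Properties.CommutativeSemigroup *-commutativeSemigroup as *-CS
open import Data.Product using (∃; ∃₂; _,_; proj₁; proj₂; uncurry; swap)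
open import Data.Product.Properties using (,-injective)
open import Data.Rational using (toℚᵘ)
import Data.Rational.Properties as ℚ
open import Data.Rational.Unnormalised as ℚᵘ using (*≡*; *≤*)
import Data.Rational.Unnormalised.Properties as ℚᵘ
open import Data.Sum as Sum using (_⊎_; inj₁; inj₂; [_,_]′)
open import Data.Sum.Properties using (inj₁-injective; inj₂-injective)
open import Data.Vec as Vec using ([]; _∷_)
open import Data.Vec.Functional using (removeAt)
open import Data.Vec.Properties using (lookup⇒[]=; []=⇒lookup)
open import Function using (_∘_; const)
open import Relation.Binary.Definitions using (Symmetric; tri<; tri≈; tri>)
open import Relation.Binary.PropositionalEquality
open import Relation.Nullary using (¬_; Dec; yes; no; _⊎-dec_)

sumℕ≡sum : ∀ {m} (f : Fin m → ℕ) → sumℕ f ≡ sum f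
sumℕ≡sum {zero}  f = refl
sumℕ≡sum {suc m} f = cong (_+_ (f zero)) (sumℕ≡sum (f ∘ suc))

prodℕ≡product : ∀ {m} (f : Fin m → ℕ) → prodℕ f ≡ Π.sum f
prodℕ≡product {zero}  f = refl
prodℕ≡product {suc m} f = cong (f zero *_) (prodℕ≡product (f ∘ suc))

∑-const : ∀ m c → ∑[ i < m ] c ≡ m * c
∑-const zero    c = refl
∑-const (suc m) c = cong (_+_ c) (∑-const m c)

∑-mono-≤ : ∀ {m} {f g : Fin m → ℕ} → (∀ i → f i ≤ g i) → ∑[ i < m ] f i ≤ ∑[ i < m ] g i
∑-mono-≤ {zero}  f≤g = z≤n
∑-mono-≤ {suc m} f≤g = +-mono-≤ (f≤g zero) (∑-mono-≤ (f≤g ∘ suc))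

sum-tabulate : ∀ {m} (f : Fin m → ℕ) → ℕ.sum (tabulate f) ≡ ∑[ i < m ] f i
sum-tabulate {zero}  f = refl
sum-tabulate {suc m} f = cong (_+_ (f zero)) (sum-tabulate (f ∘ suc))

sumℚ-cong : ∀ {m} {f g : Fin m → ℚ} → (∀ i → f i ≡ g i) → sumℚ f ≡ sumℚ g
sumℚ-cong {zero}  _   = refl
sumℚ-cong {suc m} f≗g = cong₂ ℚ._+_ (f≗g zero) (sumℚ-cong (f≗g ∘ suc))

when : ∀ {A : Set} → Dec A → ℕ → ℕ
when (yes _) x = x
when (no  _) x = 0

0<⊔ : ∀ {a b} → 0 < a ⊔ b → 0 < a ⊎ 0 < b
0<⊔ {a} {b} pos with ⊔-sel a b
... | inj₁ eq = inj₁ (subst (0 <_) eq pos)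
... | inj₂ eq = inj₂ (subst (0 <_) eq pos)

allPairs-map-All : ∀ {A : Set} {Q : A → Set} {R S : A → A → Set} →
                   (∀ {u v} → Q u → Q v → R u v → S u v) →
                   ∀ {xs} → All Q xs → AllPairs R xs → AllPairs S xs
allPairs-map-All f []         []         = []
allPairs-map-All f (qx ∷ qxs) (rx ∷ rxs) =
  All.zipWith (λ (qy , r) → f qx qy r) (qxs , rx) ∷ allPairs-map-All f qxs rxs

allPairs-lookup : ∀ {A : Set} {R : A → A → Set} {xs : List A} → Symmetric R → AllPairs R xs →
                  ∀ {i j} → i ≢ j → R (lookup xs i) (lookup xs j)
allPairs-lookup R-sym (_  ∷ _)   {zero}  {zero}  i≢j = ⊥-elim (i≢j refl)
allPairs-lookup R-sym (px ∷ _)   {zero}  {suc j} _   = All.lookup px (∈-lookup j)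
allPairs-lookup R-sym (px ∷ _)   {suc i} {zero}  _   = R-sym (All.lookup px (∈-lookup i))
allPairs-lookup R-sym (_  ∷ pxs) {suc i} {suc j} i≢j = allPairs-lookup R-sym pxs (i≢j ∘ cong suc)

∣∣≡∑ : ∀ {n} (S : Subset n) → ∣ S ∣ ≡ ∑[ t < n ] (if Vec.lookup S t then 1 else 0)
∣∣≡∑ []          = refl
∣∣≡∑ (true  ∷ S) = cong suc (∣∣≡∑ S)
∣∣≡∑ (false ∷ S) = ∣∣≡∑ S

toℚᵘ-/ : ∀ i d .{{_ : NonZero d}} → toℚᵘ (i ℚ./ d) ℚᵘ.≃ (i ℚᵘ./ d)
toℚᵘ-/ i (suc d) = ℚ.toℚᵘ-fromℚᵘ (i ℚᵘ./ suc d)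

/-cong-cross : ∀ a b c e .{{_ : NonZero b}} .{{_ : NonZero e}} → a * e ≡ c * b → + a ℚ./ b ≡ + c ℚ./ e
/-cong-cross a b@(suc _) c e@(suc _) eq = ℚ.fromℚᵘ-cong {+ a ℚᵘ./ b} {+ c ℚᵘ./ e}
  (*≡* (trans (sym (ℤ.pos-* a e)) (trans (cong +_ eq) (ℤ.pos-* c b))))

/-mono-cross : ∀ a b c e .{{_ : NonZero b}} .{{_ : NonZero e}} → a * e ≤ c * b → + a ℚ./ b ℚ.≤ + c ℚ./ e
/-mono-cross a b@(suc _) c e@(suc _) le = ℚ.toℚᵘ-cancel-≤
  (ℚᵘ.≤-respˡ-≃ (ℚᵘ.≃-sym (toℚᵘ-/ (+ a) b)) (ℚᵘ.≤-respʳ-≃ (ℚᵘ.≃-sym (toℚᵘ-/ (+ c) e))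
    (*≤* (subst₂ ℤ._≤_ (ℤ.pos-* a e) (ℤ.pos-* c b) (ℤ.+≤+ le)))))

common-denominator : ∀ a b d → (+ a ℤ.* + d ℤ.+ + b ℤ.* + d) ℤ.* + d ≡ + (a + b) ℤ.* + (d * d)
common-denominator a b d = begin
  (+ a ℤ.* + d ℤ.+ + b ℤ.* + d) ℤ.* + d   ≡⟨ cong (ℤ._* + d) (ℤ.*-distribʳ-+ (+ d) (+ a) (+ b)) ⟨
  (+ a ℤ.+ + b) ℤ.* + d ℤ.* + d           ≡⟨ ℤ.*-assoc (+ a ℤ.+ + b) (+ d) (+ d) ⟩
  (+ a ℤ.+ + b) ℤ.* (+ d ℤ.* + d)         ≡⟨ cong₂ ℤ._*_ (ℤ.pos-+ a b) (ℤ.pos-* d d) ⟨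
  + (a + b) ℤ.* + (d * d)                 ∎
  where open ≡-Reasoning

/-distrib-+ : ∀ a b d .{{_ : NonZero d}} → + (a + b) ℚ./ d ≡ + a ℚ./ d ℚ.+ + b ℚ./ d
/-distrib-+ a b d@(suc _) = ℚ.toℚᵘ-injective (ℚᵘ.≃-sym (begin
  toℚᵘ (+ a ℚ./ d ℚ.+ + b ℚ./ d)          ≈⟨ ℚ.toℚᵘ-homo-+ (+ a ℚ./ d) (+ b ℚ./ d) ⟩
  toℚᵘ (+ a ℚ./ d) ℚᵘ.+ toℚᵘ (+ b ℚ./ d)  ≈⟨ ℚᵘ.+-cong (toℚᵘ-/ (+ a) d) (toℚᵘ-/ (+ b) d) ⟩
  + a ℚᵘ./ d ℚᵘ.+ + b ℚᵘ./ d              ≈⟨ *≡* (common-denominator a b d) ⟩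
  + (a + b) ℚᵘ./ d                        ≈⟨ toℚᵘ-/ (+ (a + b)) d ⟨
  toℚᵘ (+ (a + b) ℚ./ d)                  ∎))
  where open ℚᵘ.≃-Reasoning

/-distrib-* : ∀ a b c e .{{_ : NonZero b}} .{{_ : NonZero e}} →
              (+ (a * c) ℚ./ (b * e)) {{m*n≢0 b e}} ≡ (+ a ℚ./ b) ℚ.* (+ c ℚ./ e)
/-distrib-* a b@(suc _) c e@(suc _) = ℚ.toℚᵘ-injective (ℚᵘ.≃-sym (begin
  toℚᵘ ((+ a ℚ./ b) ℚ.* (+ c ℚ./ e))      ≈⟨ ℚ.toℚᵘ-homo-* (+ a ℚ./ b) (+ c ℚ./ e) ⟩
  toℚᵘ (+ a ℚ./ b) ℚᵘ.* toℚᵘ (+ c ℚ./ e)  ≈⟨ ℚᵘ.*-cong (toℚᵘ-/ (+ a) b) (toℚᵘ-/ (+ c) e) ⟩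
  (+ a ℚᵘ./ b) ℚᵘ.* (+ c ℚᵘ./ e)          ≈⟨ *≡* (cong (ℤ._* + (b * e)) (sym (ℤ.pos-* a c))) ⟩
  + (a * c) ℚᵘ./ (b * e)                  ≈⟨ toℚᵘ-/ (+ (a * c)) (b * e) ⟨
  toℚᵘ (+ (a * c) ℚ./ (b * e))            ∎))
  where open ℚᵘ.≃-Reasoning

sumℚ-/ : ∀ {m} (w : Fin m → ℕ) d .{{_ : NonZero d}} →
         sumℚ (λ i → + w i ℚ./ d) ≡ + (∑[ i < m ] w i) ℚ./ d
sumℚ-/ {zero}  w d = sym (ℚ.0/n≡0 d)
sumℚ-/ {suc m} w d =
  trans (cong (+ w zero ℚ./ d ℚ.+_) (sumℚ-/ (w ∘ suc) d)) (sym (/-distrib-+ (w zero) _ d))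

-- Labellings and compatible orderings

variable
  d m : ℕ

-- A tuple of pairwise disjoint subsets of [m] is encoded by labelling each point with the index of its part.
Labelling : ℕ → ℕ → Set
Labelling d m = Fin m → Maybe (Fin d)

blank : Maybe (Fin d) → ℕ
blank nothing  = 1
blank (just _) = 0

hit : Fin d → Maybe (Fin d) → ℕ
hit p nothing  = 0
hit p (just q) = when (q Fin.≟ p) 1

hit-self : (p : Fin d) → hit p (just p) ≡ 1
hit-self p with p Fin.≟ p
... | yes _   = refl
... | no  p≢p = ⊥-elim (p≢p refl)

hit-other : {p q : Fin d} → q ≢ p → hit p (just q) ≡ 0
hit-other {p = p} {q = q} q≢p with q Fin.≟ p
... | yes q≡p = ⊥-elim (q≢p q≡p)
... | no  _   = refl

∑-hit : (q : Fin d) → ∑[ p < d ] hit p (just q) ≡ 1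
∑-hit {suc d} q = begin
  ∑[ p < suc d ] hit p (just q)
    ≡⟨ sum-remove {i = q} (λ p → hit p (just q)) ⟩
  hit q (just q) + ∑[ p < d ] hit (punchIn q p) (just q)
    ≡⟨ cong₂ _+_ (hit-self q) (sum-cong-≗ (λ p → hit-other (punchInᵢ≢i q p ∘ sym))) ⟩
  1 + ∑[ p < d ] 0
    ≡⟨ cong suc (sum-replicate-zero d) ⟩
  1 ∎
  where open ≡-Reasoning

blank+∑hit : (l : Maybe (Fin d)) → blank l + ∑[ p < d ] hit p l ≡ 1
blank+∑hit {d} nothing  = cong suc (sum-replicate-zero d)
blank+∑hit     (just q) = ∑-hit q

count : Labelling d m → Fin d → ℕ
count {m = m} T p = ∑[ t < m ] hit p (T t)

size : Labelling d m → ℕ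
size {d} T = ∑[ p < d ] count T p

blanks : Labelling d m → ℕ
blanks {m = m} T = ∑[ t < m ] blank (T t)

weight : Labelling d m → ℕ
weight T = Π.sum (λ p → count T p !)

size+blanks : (T : Labelling d m) → size T + blanks T ≡ m
size+blanks {d} {m} T = begin
  size T + blanks T
    ≡⟨ cong (_+ blanks T) (∑-comm (λ p t → hit p (T t))) ⟩
  ∑[ t < m ] ∑[ p < d ] hit p (T t) + blanks T
    ≡⟨ ∑-distrib-+ (λ t → ∑[ p < d ] hit p (T t)) (blank ∘ T) ⟨
  ∑[ t < m ] (∑[ p < d ] hit p (T t) + blank (T t))
    ≡⟨ sum-cong-≗ (λ t → trans (+-comm _ (blank (T t))) (blank+∑hit (T t))) ⟩
  ∑[ t < m ] 1
    ≡⟨ trans (∑-const m 1) (*-identityʳ m) ⟩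
  m ∎
  where open ≡-Reasoning

count-removeAt : (T : Labelling d (suc m)) (x : Fin (suc m)) (p : Fin d) →
                 count T p ≡ hit p (T x) + count (removeAt T x) p
count-removeAt T x p = sum-remove {i = x} (λ t → hit p (T t))

module _ (T : Labelling d (suc m)) {x : Fin (suc m)} where

  private
    T′ : Labelling d m
    T′ = removeAt T x

  module _ (Tx≡nothing : T x ≡ nothing) where

    count-removeAt-blank : ∀ p → count T′ p ≡ count T p
    count-removeAt-blank p = sym (trans (count-removeAt T x p) (cong (λ l → hit p l + count T′ p) Tx≡nothing))

    size-removeAt-blank : size T′ ≡ size T
    size-removeAt-blank = sum-cong-≗ count-removeAt-blank

    weight-removeAt-blank : weight T′ ≡ weight T
    weight-removeAt-blank = Π.sum-cong-≗ (cong _! ∘ count-removeAt-blank)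

module _ (T : Labelling (suc d) (suc m)) {x : Fin (suc m)} {p : Fin (suc d)} (Tx≡p : T x ≡ just p) where

  private
    T′ : Labelling (suc d) m
    T′ = removeAt T x

  count-removeAt-label : ∀ q → count T q ≡ hit q (just p) + count T′ q
  count-removeAt-label q = trans (count-removeAt T x q) (cong (λ l → hit q l + count T′ q) Tx≡p)

  size-removeAt-label : size T ≡ suc (size T′)
  size-removeAt-label = begin
    size T                                         ≡⟨ sum-cong-≗ count-removeAt-label ⟩
    ∑[ q < suc d ] (hit q (just p) + count T′ q)   ≡⟨ ∑-distrib-+ (λ q → hit q (just p)) (count T′) ⟩
    ∑[ q < suc d ] hit q (just p) + size T′        ≡⟨ cong (_+ size T′) (∑-hit p) ⟩
    suc (size T′)                                  ∎
    where open ≡-Reasoning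

  weight-removeAt-label : weight T ≡ count T p * weight T′
  weight-removeAt-label = begin
    weight T
      ≡⟨ Π.sum-remove {i = p} (λ q → count T q !) ⟩
    count T p ! * Π.sum (λ q → count T (punchIn p q) !)
      ≡⟨ cong₂ (λ a b → a ! * b) cTp (Π.sum-cong-≗ (cong _! ∘ off-p)) ⟩
    suc c′ ! * Π.sum (λ q → count T′ (punchIn p q) !)
      ≡⟨ *-assoc (suc c′) (c′ !) _ ⟩
    suc c′ * (c′ ! * Π.sum (λ q → count T′ (punchIn p q) !))
      ≡⟨ cong₂ _*_ cTp (Π.sum-remove {i = p} (λ q → count T′ q !)) ⟨
    count T p * weight T′ ∎
    where
    open ≡-Reasoning
    c′ : ℕ
    c′ = count T′ p
    cTp : count T p ≡ suc c′
    cTp = trans (count-removeAt-label p) (cong (_+ c′) (hit-self p))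
    off-p : ∀ q → count T (punchIn p q) ≡ count T′ (punchIn p q)
    off-p q = trans (count-removeAt-label (punchIn p q))
                    (cong (_+ count T′ (punchIn p q)) (hit-other (punchInᵢ≢i p q ∘ sym)))

Removable : Labelling d (suc m) → Fin (suc m) → Set
Removable T x = Maybe.All (λ r → ∀ t → Maybe.All (Fin._≤ r) (T t)) (T x)

removable? : (T : Labelling d (suc m)) (x : Fin (suc m)) → Dec (Removable T x)
removable? T x = Maybe.dec (λ r → all? (λ t → Maybe.dec (λ s → toℕ s ≤? toℕ r) (T t))) (T x)

blank⇒removable : (T : Labelling d (suc m)) {x : Fin (suc m)} → T x ≡ nothing → Removable T x
blank⇒removable T Tx≡nothing = subst (Maybe.All _) (sym Tx≡nothing) Maybe.nothing

TopLabel : Labelling d m → Fin d → Set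
TopLabel T p = (∃ λ t → T t ≡ just p) × (∀ t → Maybe.All (Fin._≤ p) (T t))

blank-or-top : (T : Labelling d m) → (∀ t → T t ≡ nothing) ⊎ ∃ (TopLabel T)
blank-or-top {m = zero}  T = inj₁ λ ()
blank-or-top {m = suc m} T with T zero in T0 | blank-or-top (T ∘ suc)
... | nothing | inj₁ blank = inj₁ λ { zero → T0 ; (suc t) → blank t }
... | nothing | inj₂ (p , (t , Tt) , below) = inj₂ (p , (suc t , Tt) , λ
  { zero    → subst (Maybe.All _) (sym T0) Maybe.nothing
  ; (suc t) → below t })
... | just q  | inj₁ blank = inj₂ (q , (zero , T0) , λ
  { zero    → subst (Maybe.All _) (sym T0) (Maybe.just ≤-refl)
  ; (suc t) → subst (Maybe.All _) (sym (blank t)) Maybe.nothing })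
... | just q  | inj₂ (p , (t , Tt) , below) with toℕ q ≤? toℕ p
...   | yes q≤p = inj₂ (p , (suc t , Tt) , λ
  { zero    → subst (Maybe.All _) (sym T0) (Maybe.just q≤p)
  ; (suc t) → below t })
...   | no  q≰p = inj₂ (q , (zero , T0) , λ
  { zero    → subst (Maybe.All _) (sym T0) (Maybe.just ≤-refl)
  ; (suc t) → Maybe.map (λ r≤p → ≤-trans r≤p (<⇒≤ (≰⇒> q≰p))) (below t) })

-- orders m T counts the orderings of the m points in which the labelled points appear in increasing
-- order of labels; the last point must be unlabelled or carry the largest label present.
orders : ∀ m → Labelling d m → ℕ
ordersEndingAt : Labelling d (suc m) → Fin (suc m) → ℕ

orders zero    T = 1
orders (suc m) T = ∑[ x < suc m ] ordersEndingAt T x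

ordersEndingAt {m = m} T x = when (removable? T x) (orders m (removeAt T x))

module _ (T : Labelling d (suc m)) (x : Fin (suc m)) where

  ordersEndingAt-removable : Removable T x → ordersEndingAt T x ≡ orders m (removeAt T x)
  ordersEndingAt-removable r with removable? T x
  ... | yes _  = refl
  ... | no  ¬r = ⊥-elim (¬r r)

  ordersEndingAt-blocked : ¬ Removable T x → ordersEndingAt T x ≡ 0
  ordersEndingAt-blocked ¬r with removable? T x
  ... | yes r = ⊥-elim (¬r r)
  ... | no  _ = refl

OrdersFormula : ℕ → ℕ → Set
OrdersFormula d m = ∀ (T : Labelling d m) → orders m T * size T ! ≡ weight T * m !

module _ (formula : OrdersFormula d m) (T : Labelling d (suc m)) where

  ordersEndingAt-blank : ∀ {x} → T x ≡ nothing → ordersEndingAt T x * size T ! ≡ weight T * m !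
  ordersEndingAt-blank {x} Tx≡nothing = begin
    ordersEndingAt T x * size T !  ≡⟨ cong₂ (λ o s → o * s !) (ordersEndingAt-removable T x (blank⇒removable T Tx≡nothing))
                                                             (sym (size-removeAt-blank T Tx≡nothing)) ⟩
    orders m T′ * size T′ !        ≡⟨ formula T′ ⟩
    weight T′ * m !                ≡⟨ cong (_* m !) (weight-removeAt-blank T Tx≡nothing) ⟩
    weight T * m !                 ∎
    where
    open ≡-Reasoning
    T′ : Labelling d m
    T′ = removeAt T x

  orders-all-blank : (∀ t → T t ≡ nothing) → orders (suc m) T * size T ! ≡ weight T * suc m !
  orders-all-blank blank = begin
    orders (suc m) T * size T !                     ≡⟨ *-distribʳ-sum (size T !) (ordersEndingAt T) ⟩
    ∑[ x < suc m ] (ordersEndingAt T x * size T !)  ≡⟨ sum-cong-≗ (ordersEndingAt-blank ∘ blank) ⟩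
    ∑[ x < suc m ] (weight T * m !)                 ≡⟨ ∑-const (suc m) (weight T * m !) ⟩
    suc m * (weight T * m !)                        ≡⟨ *-CS.x∙yz≈y∙xz (suc m) (weight T) (m !) ⟩
    weight T * suc m !                              ∎
    where open ≡-Reasoning

private
  rearrange : ∀ c o s f → c * (o * (s * f)) ≡ s * (c * (o * f))
  rearrange = solve-∀

  regroup : ∀ b c s w → b * (c * w) + c * (s * w) ≡ c * ((s + b) * w)
  regroup = solve-∀

-- For x labelled p, weight T ≡ c * weight (removeAt T x) with c the number of points labelled p,
-- so the terms below are multiplied by c.
module _ (formula : OrdersFormula (suc d) m) (T : Labelling (suc d) (suc m)) {p : Fin (suc d)} (top : TopLabel T p)
  where

  private
    c A B : ℕ
    c = count T p
    A = c * (weight T * m !)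
    B = size T * (weight T * m !)
    t₀ : Fin (suc m)
    t₀ = proj₁ (proj₁ top)
    Tt₀ : T t₀ ≡ just p
    Tt₀ = proj₂ (proj₁ top)
    below : ∀ t → Maybe.All (Fin._≤ p) (T t)
    below = proj₂ top

  ordersEndingAt-top : ∀ {x} → T x ≡ just p → c * (ordersEndingAt T x * size T !) ≡ B
  ordersEndingAt-top {x} Tx≡p = begin
    c * (ordersEndingAt T x * size T !)  ≡⟨ cong₂ (λ o s → c * (o * s !)) (ordersEndingAt-removable T x removable)
                                                                        (size-removeAt-label T Tx≡p) ⟩
    c * (orders m T′ * (suc s′ * s′ !))  ≡⟨ rearrange c (orders m T′) (suc s′) (s′ !) ⟩
    suc s′ * (c * (orders m T′ * s′ !))  ≡⟨ cong (λ z → suc s′ * (c * z)) (formula T′) ⟩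
    suc s′ * (c * (weight T′ * m !))     ≡⟨ cong (suc s′ *_) (*-assoc c (weight T′) (m !)) ⟨
    suc s′ * (c * weight T′ * m !)       ≡⟨ cong₂ (λ s w → s * (w * m !)) (size-removeAt-label T Tx≡p)
                                                                         (weight-removeAt-label T Tx≡p) ⟨
    B                                    ∎
    where
    open ≡-Reasoning
    T′ : Labelling (suc d) m
    T′ = removeAt T x
    s′ : ℕ
    s′ = size T′
    removable : Removable T x
    removable = subst (Maybe.All _) (sym Tx≡p) (Maybe.just below)

  ordersEndingAt-below : ∀ {x q} → T x ≡ just q → q ≢ p → ordersEndingAt T x ≡ 0
  ordersEndingAt-below {x} {q} Tx≡q q≢p = ordersEndingAt-blocked T x λ removable →
    let q-max = Maybe.drop-just (subst (Maybe.All _) Tx≡q removable)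
        p≤q   = Maybe.drop-just (subst (Maybe.All _) Tt₀ (q-max t₀))
        q≤p   = Maybe.drop-just (subst (Maybe.All _) Tx≡q (below x))
    in q≢p (toℕ-injective (≤-antisym q≤p p≤q))

  ordersEndingAt-split : ∀ x → c * (ordersEndingAt T x * size T !) ≡ blank (T x) * A + hit p (T x) * B
  ordersEndingAt-split x = split (T x) refl
    where
    split : ∀ l → T x ≡ l → c * (ordersEndingAt T x * size T !) ≡ blank l * A + hit p l * B
    split nothing Tx =
      trans (cong (c *_) (ordersEndingAt-blank formula T Tx)) (sym (trans (+-identityʳ _) (*-identityˡ A)))
    split (just q) Tx with q Fin.≟ p
    ... | yes refl = trans (ordersEndingAt-top Tx) (sym (+-identityʳ B))
    ... | no  q≢p  = trans (cong (λ o → c * (o * size T !)) (ordersEndingAt-below Tx q≢p)) (*-zeroʳ c)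

  instance
    count-top-nonZero : NonZero c
    count-top-nonZero rewrite count-removeAt-label T Tt₀ p | hit-self p = _

  orders-top : orders (suc m) T * size T ! ≡ weight T * suc m !
  orders-top = *-cancelˡ-≡ _ _ c (begin
    c * (orders (suc m) T * size T !)
      ≡⟨ cong (c *_) (*-distribʳ-sum (size T !) (ordersEndingAt T)) ⟩
    c * ∑[ x < suc m ] (ordersEndingAt T x * size T !)
      ≡⟨ *-distribˡ-sum c (λ x → ordersEndingAt T x * size T !) ⟩
    ∑[ x < suc m ] (c * (ordersEndingAt T x * size T !))
      ≡⟨ sum-cong-≗ ordersEndingAt-split ⟩
    ∑[ x < suc m ] (blank (T x) * A + hit p (T x) * B)
      ≡⟨ ∑-distrib-+ (λ x → blank (T x) * A) (λ x → hit p (T x) * B) ⟩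
    ∑[ x < suc m ] (blank (T x) * A) + ∑[ x < suc m ] (hit p (T x) * B)
      ≡⟨ cong₂ _+_ (*-distribʳ-sum A (blank ∘ T)) (*-distribʳ-sum B (λ x → hit p (T x))) ⟨
    blanks T * A + c * B
      ≡⟨ regroup (blanks T) c (size T) (weight T * m !) ⟩
    c * ((size T + blanks T) * (weight T * m !))
      ≡⟨ cong (λ k → c * (k * (weight T * m !))) (size+blanks T) ⟩
    c * (suc m * (weight T * m !))
      ≡⟨ cong (c *_) (*-CS.x∙yz≈y∙xz (suc m) (weight T) (m !)) ⟩
    c * (weight T * suc m !) ∎)
    where open ≡-Reasoning

orders-empty : OrdersFormula d 0
orders-empty {d} T = begin
  1 * size T !       ≡⟨ cong (λ s → 1 * s !) (sum-replicate-zero d) ⟩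
  1                  ≡⟨ Π.sum-replicate-zero d ⟨
  weight T           ≡⟨ *-identityʳ (weight T) ⟨
  weight T * 1       ∎
  where open ≡-Reasoning

orders-formula : ∀ m → OrdersFormula d m
orders-formula zero = orders-empty
orders-formula (suc m) T with blank-or-top T
... | inj₁ blank = orders-all-blank (orders-formula m) T blank
orders-formula {suc d} (suc m) T | inj₂ (p , top) = orders-top (orders-formula m) T top

-- Antichains of monotone sequences

Monotone : ℕ → (ℕ → ℕ) → Set
Monotone r a = ∀ {i j} → i ≤ j → j < r → a i ≤ a j

Bounded : ℕ → ℕ → (ℕ → ℕ) → Set
Bounded n r a = ∀ {i} → i < r → a i ≤ n

Agree : ℕ → (ℕ → ℕ) → (ℕ → ℕ) → Set
Agree r a b = ∀ {i} → i < r → a i ≡ b i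

Below : ℕ → (ℕ → ℕ) → (ℕ → ℕ) → Set
Below r a b = ∀ {i} → i < r → a i ≤ b i

Exceeds : ℕ → (ℕ → ℕ) → (ℕ → ℕ) → Set
Exceeds r a b = ∃ λ i → i < r × b i < a i

Incomparable : ℕ → (ℕ → ℕ) → (ℕ → ℕ) → Set
Incomparable r a b = Exceeds r a b × Exceeds r b a

below⇒¬exceeds : ∀ {r a b} → Below r a b → ¬ Exceeds r a b
below⇒¬exceeds a≤b (i , i<r , b<a) = <⇒≱ b<a (a≤b i<r)

-- M n r counts the monotone sequences of length r with values in [0, n], and rank enumerates them.
M : ℕ → ℕ → ℕ
M n       zero    = 1
M zero    (suc r) = 1
M (suc n) (suc r) = M (suc n) r + M n (suc r)

rank : ∀ n r → (ℕ → ℕ) → Fin (M n r)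
rank n       zero    a = zero
rank zero    (suc r) a = zero
rank (suc n) (suc r) a with a 0
... | zero  = rank (suc n) r (a ∘ suc) ↑ˡ M n (suc r)
... | suc _ = M (suc n) r ↑ʳ rank n (suc r) (pred ∘ a)

↑ˡ≢↑ʳ : ∀ {m n} (i : Fin m) (j : Fin n) → i ↑ˡ n ≢ m ↑ʳ j
↑ˡ≢↑ʳ {m} {n} i j eq
  with () ← trans (sym (splitAt-↑ˡ m i n)) (trans (cong (splitAt m) eq) (splitAt-↑ʳ m n j))

rank-injective : ∀ n r {a b} → Monotone r a → Bounded n r a → Monotone r b → Bounded n r b →
                 rank n r a ≡ rank n r b → Agree r a b
rank-injective n       zero    _ _ _ _ _ ()
rank-injective zero    (suc r) _ a≤0 _ b≤0 _ i<r = trans (n≤0⇒n≡0 (a≤0 i<r)) (sym (n≤0⇒n≡0 (b≤0 i<r)))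
rank-injective (suc n) (suc r) {a} {b} mono-a bnd-a mono-b bnd-b with a 0 in a0 | b 0 in b0
... | zero  | zero  = λ eq → λ
  { {zero}  _         → trans a0 (sym b0)
  ; {suc i} (s≤s i<r) → tails (↑ˡ-injective _ _ _ eq) i<r }
  where
  tails : rank (suc n) r (a ∘ suc) ≡ rank (suc n) r (b ∘ suc) → Agree r (a ∘ suc) (b ∘ suc)
  tails = rank-injective (suc n) r (λ i≤j j<r → mono-a (s≤s i≤j) (s≤s j<r)) (bnd-a ∘ s≤s)
                                   (λ i≤j j<r → mono-b (s≤s i≤j) (s≤s j<r)) (bnd-b ∘ s≤s)
... | zero  | suc _ = λ eq → ⊥-elim (↑ˡ≢↑ʳ _ _ eq)
... | suc _ | zero  = λ eq → ⊥-elim (↑ˡ≢↑ʳ _ _ (sym eq))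
... | suc _ | suc _ = λ eq i<r →
  pred-injective {{>-nonZero (positive mono-a a0 i<r)}} {{>-nonZero (positive mono-b b0 i<r)}}
                 (preds (↑ʳ-injective _ _ _ eq) i<r)
  where
  preds : rank n (suc r) (pred ∘ a) ≡ rank n (suc r) (pred ∘ b) → Agree (suc r) (pred ∘ a) (pred ∘ b)
  preds = rank-injective n (suc r) (λ i≤j j<r → pred-mono-≤ (mono-a i≤j j<r)) (pred-mono-≤ ∘ bnd-a)
                                   (λ i≤j j<r → pred-mono-≤ (mono-b i≤j j<r)) (pred-mono-≤ ∘ bnd-b)
  positive : ∀ {c u i} → Monotone (suc r) c → c 0 ≡ suc u → i < suc r → 0 < c i
  positive mono c0 i<r = <-≤-trans (subst (0 <_) (sym c0) z<s) (mono z≤n i<r)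

punch : ℕ → ℕ → ℕ
punch zero    i       = suc i
punch (suc j) zero    = zero
punch (suc j) (suc i) = suc (punch j i)

del : ℕ → (ℕ → ℕ) → ℕ → ℕ
del j a = a ∘ punch j

punch-< : ∀ {i j} → i < j → punch j i ≡ i
punch-< {zero}  {suc j} _         = refl
punch-< {suc i} {suc j} (s≤s i<j) = cong suc (punch-< i<j)

punch-≥ : ∀ {i j} → j ≤ i → punch j i ≡ suc i
punch-≥ {i}     {zero}  _         = refl
punch-≥ {suc i} {suc j} (s≤s j≤i) = cong suc (punch-≥ j≤i)

punch-≤ : ∀ j i → punch j i ≤ suc i
punch-≤ zero    i       = ≤-refl
punch-≤ (suc j) zero    = z≤n
punch-≤ (suc j) (suc i) = s≤s (punch-≤ j i)

punch-mono : ∀ j {i i′} → i ≤ i′ → punch j i ≤ punch j i′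
punch-mono zero    i≤i′       = s≤s i≤i′
punch-mono (suc j) {zero}  _  = z≤n
punch-mono (suc j) (s≤s i≤i′) = s≤s (punch-mono j i≤i′)

punch-≥self : ∀ j i → i ≤ punch j i
punch-≥self zero    i       = n≤1+n i
punch-≥self (suc j) zero    = z≤n
punch-≥self (suc j) (suc i) = s≤s (punch-≥self j i)

monotone-del : ∀ {r a} j → Monotone r a → Monotone (pred r) (del j a)
monotone-del {suc r} j mono i≤i′ i′<r = mono (punch-mono j i≤i′) (≤-trans (s≤s (punch-≤ j _)) (s≤s i′<r))

bounded-del : ∀ {n r a} j → Bounded n r a → Bounded n (pred r) (del j a)
bounded-del {r = suc r} j bnd i<r = bnd (≤-trans (s≤s (punch-≤ j _)) (s≤s i<r))

agree-off : ∀ {r j a b} → j ≤ r → Agree r (del j a) (del j b) → ∀ {p} → p < suc r → p ≢ j → a p ≡ b p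
agree-off {j = j} {a} {b} j≤r agree {p} p<r p≢j with <-cmp p j
... | tri< p<j _ _ = subst (λ q → a q ≡ b q) (punch-< p<j) (agree (<-≤-trans p<j j≤r))
... | tri≈ _ p≡j _ = ⊥-elim (p≢j p≡j)
agree-off {j = j} {a} {b} j≤r agree {suc i} p<r p≢j | tri> _ _ (s≤s j≤i) =
  subst (λ q → a q ≡ b q) (punch-≥ j≤i) (agree (≤-pred p<r))

agree-shifted⇒below : ∀ {r j j′ a b} → j < j′ → j′ ≤ r → Monotone (suc r) a → Monotone (suc r) b →
                      Agree r (del j a) (del j′ b) → Below (suc r) a b
agree-shifted⇒below {r} {j} {j′} {a} {b} j<j′ j′≤r mono-a mono-b agree {p} p<r with p <? j′
... | yes p<j′ = begin
  a p                ≤⟨ mono-a (punch-≥self j p) (s≤s (≤-trans (punch-≤ j p) (<-≤-trans p<j′ j′≤r))) ⟩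
  a (punch j p)      ≡⟨ agree (<-≤-trans p<j′ j′≤r) ⟩
  b (punch j′ p)     ≡⟨ cong b (punch-< p<j′) ⟩
  b p                ∎
  where open ≤-Reasoning
... | no p≮j′ with suc i ← p | s≤s j≤i ← ≤-trans j<j′ (≮⇒≥ p≮j′) = begin
  a (suc i)          ≡⟨ cong a (punch-≥ j≤i) ⟨
  a (punch j i)      ≡⟨ agree (≤-pred p<r) ⟩
  b (punch j′ i)     ≤⟨ mono-b (punch-≤ j′ i) p<r ⟩
  b (suc i)          ∎
  where open ≤-Reasoning

agree-shifted⇒plateau : ∀ {r j j′ a} → j < j′ → j′ ≤ r → Agree r (del j a) (del j′ a) → a (suc j) ≡ a j
agree-shifted⇒plateau {j = j} {j′} {a} j<j′ j′≤r agree = begin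
  a (suc j)          ≡⟨ cong a (punch-≥ ≤-refl) ⟨
  a (punch j j)      ≡⟨ agree (<-≤-trans j<j′ j′≤r) ⟩
  a (punch j′ j)     ≡⟨ cong a (punch-< j<j′) ⟩
  a j                ∎
  where open ≡-Reasoning

agree-off₂ : ∀ {r j a b} → j < r → Agree (pred r) (del j (del j a)) (del j (del j b)) →
             ∀ {p} → p < suc r → p ≢ j → p ≢ suc j → a p ≡ b p
agree-off₂ {suc r} {j} {a} {b} (s≤s j≤r) agree {p} p<r p≢j p≢sj with <-cmp p j
... | tri< p<j _ _ = subst (λ q → a q ≡ b q) (punch-< p<j) (once (≤-trans p<j (m≤n⇒m≤1+n j≤r)) p≢j)
  where
  once : ∀ {q} → q < suc r → q ≢ j → del j a q ≡ del j b q
  once = agree-off j≤r agree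
... | tri≈ _ p≡j _ = ⊥-elim (p≢j p≡j)
agree-off₂ {suc r} {j} {a} {b} (s≤s j≤r) agree {suc q} p<r p≢j p≢sj | tri> _ _ (s≤s j≤q) =
  subst (λ q → a q ≡ b q) (punch-≥ j≤q) (agree-off j≤r agree (≤-pred p<r) (p≢sj ∘ cong suc))

below-off : ∀ {r j a b} → a j ≤ b j → (∀ {p} → p < r → p ≢ j → a p ≡ b p) → Below r a b
below-off {j = j} aj≤bj agree {p} p<r with p ≟ j
... | yes refl = aj≤bj
... | no  p≢j  = ≤-reflexive (agree p<r p≢j)

below-off₂ : ∀ {r j a b} → a j ≤ b j → a j ≡ a (suc j) → b j ≡ b (suc j) →
             (∀ {p} → p < r → p ≢ j → p ≢ suc j → a p ≡ b p) → Below r a b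
below-off₂ {j = j} aj≤bj a-flat b-flat agree {p} p<r with p ≟ j | p ≟ suc j
... | yes refl | _        = aj≤bj
... | no _     | yes refl = subst₂ _≤_ a-flat b-flat aj≤bj
... | no p≢j   | no p≢sj  = ≤-reflexive (agree p<r p≢j p≢sj)

incomparable-off : ∀ {r j a b} → Incomparable r a b → ¬ (∀ {p} → p < r → p ≢ j → a p ≡ b p)
incomparable-off {j = j} {a} {b} (a>b , b>a) agree with a j ≤? b j
... | yes aj≤bj = below⇒¬exceeds (below-off aj≤bj agree) a>b
... | no  aj≰bj = below⇒¬exceeds (below-off (<⇒≤ (≰⇒> aj≰bj)) (λ p<r p≢j → sym (agree p<r p≢j))) b>a

incomparable-off₂ : ∀ {r j a b} → Incomparable r a b → a j ≡ a (suc j) → b j ≡ b (suc j) →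
                    ¬ (∀ {p} → p < r → p ≢ j → p ≢ suc j → a p ≡ b p)
incomparable-off₂ {j = j} {a} {b} (a>b , b>a) a-flat b-flat agree with a j ≤? b j
... | yes aj≤bj = below⇒¬exceeds (below-off₂ aj≤bj a-flat b-flat agree) a>b
... | no  aj≰bj = below⇒¬exceeds (below-off₂ (<⇒≤ (≰⇒> aj≰bj)) b-flat a-flat
                                              (λ p<r p≢j p≢sj → sym (agree p<r p≢j p≢sj))) b>a

module Coding (n r : ℕ) where

  Admissible : (ℕ → ℕ) → Set
  Admissible a = Monotone (suc r) a × Bounded n (suc r) a

  Code : Set
  Code = Fin (M n r) ⊎ (Fin r × Fin (M n (pred r)))

  Ascent : (ℕ → ℕ) → ℕ → Set
  Ascent a j = r ≤ j ⊎ a j < a (suc j)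

  ascent? : ∀ a j → Dec (Ascent a j)
  ascent? a j = r ≤? j ⊎-dec a j <? a (suc j)

  plateau : ∀ {a j} → Monotone (suc r) a → ¬ Ascent a j → j < r × a j ≡ a (suc j)
  plateau {j = j} mono ¬asc = j<r , ≤-antisym (mono (n≤1+n j) (s≤s j<r)) (≮⇒≥ (¬asc ∘ inj₂))
    where
    j<r : j < r
    j<r = ≰⇒> (¬asc ∘ inj₁)

  -- Deleting entry j is recorded by the remaining sequence, except at a plateau a j ≡ a (suc j) with
  -- j < r, where both entries are deleted and j is recorded. Over an antichain the codes are distinct.
  code : (ℕ → ℕ) → ℕ → Code
  code a j with ascent? a j
  ... | yes _   = inj₁ (rank n r (del j a))
  ... | no ¬asc = inj₂ (fromℕ< (≰⇒> (¬asc ∘ inj₁)) , rank n (pred r) (del j (del j a)))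

  code-ascent : ∀ {a j} → Ascent a j → code a j ≡ inj₁ (rank n r (del j a))
  code-ascent {a} {j} asc with ascent? a j
  ... | yes _   = refl
  ... | no ¬asc = ⊥-elim (¬asc asc)

  code-plateau : ∀ {a j} (¬asc : ¬ Ascent a j) →
                 code a j ≡ inj₂ (fromℕ< (≰⇒> (¬asc ∘ inj₁)) , rank n (pred r) (del j (del j a)))
  code-plateau {a} {j} ¬asc with ascent? a j
  ... | yes asc = ⊥-elim (¬asc asc)
  ... | no  _   = refl

  agree-ascents : ∀ {a b j j′} → Admissible a → Admissible b → Ascent a j → Ascent b j′ →
                  code a j ≡ code b j′ → Agree r (del j a) (del j′ b)
  agree-ascents {j = j} {j′} (mono-a , bnd-a) (mono-b , bnd-b) asc asc′ eq =
    rank-injective n r (monotone-del j mono-a) (bounded-del j bnd-a) (monotone-del j′ mono-b) (bounded-del j′ bnd-b)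
      (inj₁-injective (trans (sym (code-ascent asc)) (trans eq (code-ascent asc′))))

  agree-plateaus : ∀ {a b j j′} → Admissible a → Admissible b → ¬ Ascent a j → ¬ Ascent b j′ →
                   code a j ≡ code b j′ → j ≡ j′ × Agree (pred r) (del j (del j a)) (del j′ (del j′ b))
  agree-plateaus {j = j} {j′} (mono-a , bnd-a) (mono-b , bnd-b) ¬asc ¬asc′ eq
    with ,-injective (inj₂-injective (trans (sym (code-plateau ¬asc)) (trans eq (code-plateau ¬asc′))))
  ... | j≡j′ , ranks≡ =
    fromℕ<-injective j j′ _ _ j≡j′ ,
    rank-injective n (pred r) (monotone-del j (monotone-del j mono-a)) (bounded-del j (bounded-del j bnd-a))
                              (monotone-del j′ (monotone-del j′ mono-b)) (bounded-del j′ (bounded-del j′ bnd-b)) ranks≡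

  ascent≢plateau : ∀ {a b j j′} → Ascent a j → ¬ Ascent b j′ → code a j ≢ code b j′
  ascent≢plateau asc ¬asc′ eq with () ← trans (sym (code-ascent asc)) (trans eq (code-plateau ¬asc′))

  ascent⇒¬plateau : ∀ {a j} → Ascent a j → j < r → a (suc j) ≢ a j
  ascent⇒¬plateau (inj₁ r≤j)    j<r _  = <⇒≱ j<r r≤j
  ascent⇒¬plateau (inj₂ aj<asj) _   eq = <-irrefl (sym eq) aj<asj

  code-injectiveʳ : ∀ {a j j′} → Admissible a → j < suc r → j′ < suc r → code a j ≡ code a j′ → j ≡ j′
  code-injectiveʳ {a} {j} {j′} adm j≤r j′≤r eq = go (ascent? a j) (ascent? a j′)
    where
    go : Dec (Ascent a j) → Dec (Ascent a j′) → j ≡ j′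
    go (yes asc) (yes asc′) with <-cmp j j′
    ... | tri< j<j′ _ _ = ⊥-elim (ascent⇒¬plateau {a} asc (<-≤-trans j<j′ (≤-pred j′≤r))
                            (agree-shifted⇒plateau {a = a} j<j′ (≤-pred j′≤r) (agree-ascents adm adm asc asc′ eq)))
    ... | tri≈ _ j≡j′ _ = j≡j′
    ... | tri> _ _ j′<j = ⊥-elim (ascent⇒¬plateau {a} asc′ (<-≤-trans j′<j (≤-pred j≤r))
                            (agree-shifted⇒plateau {a = a} j′<j (≤-pred j≤r) (agree-ascents adm adm asc′ asc (sym eq))))
    go (yes asc) (no ¬asc′) = ⊥-elim (ascent≢plateau asc ¬asc′ eq)
    go (no ¬asc) (yes asc′) = ⊥-elim (ascent≢plateau asc′ ¬asc (sym eq))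
    go (no ¬asc) (no ¬asc′) = proj₁ (agree-plateaus adm adm ¬asc ¬asc′ eq)

  code-separates : ∀ {a b j j′} → Admissible a → Admissible b → Incomparable (suc r) a b →
                   j < suc r → j′ < suc r → code a j ≢ code b j′
  code-separates {a} {b} {j} {j′} adm-a adm-b inc j≤r j′≤r eq = go (ascent? a j) (ascent? b j′)
    where
    go : Dec (Ascent a j) → Dec (Ascent b j′) → ⊥
    go (yes asc) (yes asc′) with <-cmp j j′ | agree-ascents adm-a adm-b asc asc′ eq
    ... | tri< j<j′ _ _ | agree =
      below⇒¬exceeds (agree-shifted⇒below j<j′ (≤-pred j′≤r) (proj₁ adm-a) (proj₁ adm-b) agree) (proj₁ inc)
    ... | tri> _ _ j′<j | agree =
      below⇒¬exceeds (agree-shifted⇒below j′<j (≤-pred j≤r) (proj₁ adm-b) (proj₁ adm-a) (sym ∘ agree)) (proj₂ inc)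
    ... | tri≈ _ refl _ | agree = incomparable-off inc (agree-off (≤-pred j≤r) agree)
    go (yes asc) (no ¬asc′) = ascent≢plateau asc ¬asc′ eq
    go (no ¬asc) (yes asc′) = ascent≢plateau asc′ ¬asc (sym eq)
    go (no ¬asc) (no ¬asc′) with agree-plateaus adm-a adm-b ¬asc ¬asc′ eq
    ... | refl , agree with plateau (proj₁ adm-a) ¬asc | plateau (proj₁ adm-b) ¬asc′
    ...   | j<r , a-flat | _ , b-flat = incomparable-off₂ inc a-flat b-flat (agree-off₂ j<r agree)

  encode : Code → Fin (M n r + r * M n (pred r))
  encode = join (M n r) (r * M n (pred r)) ∘ Sum.map₂ (uncurry combine)

  unjoin : ∀ c c′ → encode c ≡ encode c′ → Sum.map₂ (uncurry combine) c ≡ Sum.map₂ (uncurry combine) c′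
  unjoin _ _ eq = trans (sym (splitAt-join _ _ _)) (trans (cong (splitAt (M n r)) eq) (splitAt-join _ _ _))

  encode-injective : ∀ {c c′} → encode c ≡ encode c′ → c ≡ c′
  encode-injective {c@(inj₁ _)}       {c′@(inj₁ _)}         eq with refl ← unjoin c c′ eq = refl
  encode-injective {c@(inj₁ _)}       {c′@(inj₂ _)}         eq with () ← unjoin c c′ eq
  encode-injective {c@(inj₂ _)}       {c′@(inj₁ _)}         eq with () ← unjoin c c′ eq
  encode-injective {c@(inj₂ (i , j))} {c′@(inj₂ (i′ , j′))} eq
    with refl , refl ← combine-injective i j i′ j′ (inj₂-injective (unjoin c c′ eq)) = refl

  antichain-bound : (A : List (ℕ → ℕ)) → All Admissible A → AllPairs (Incomparable (suc r)) A →
                    length A * suc r ≤ M n r + r * M n (pred r)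
  antichain-bound A admissible incomparable = injective⇒≤ {f = encode ∘ codeAt ∘ split} injective
    where
    split : Fin (length A * suc r) → Fin (length A) × Fin (suc r)
    split = remQuot (suc r)

    codeAt : Fin (length A) × Fin (suc r) → Code
    codeAt (i , j) = code (lookup A i) (toℕ j)

    admissibleAt : ∀ i → Admissible (lookup A i)
    admissibleAt i = All.lookup admissible (∈-lookup i)

    codeAt-injective : ∀ {x y} → codeAt x ≡ codeAt y → x ≡ y
    codeAt-injective {i , j} {i′ , j′} eq with i Fin.≟ i′
    ... | yes refl = cong (i ,_) (toℕ-injective (code-injectiveʳ (admissibleAt i) (toℕ<n j) (toℕ<n j′) eq))
    ... | no  i≢i′ = ⊥-elim (code-separates (admissibleAt i) (admissibleAt i′)
                                            (allPairs-lookup swap incomparable i≢i′) (toℕ<n j) (toℕ<n j′) eq)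

    injective : ∀ {x y} → encode (codeAt (split x)) ≡ encode (codeAt (split y)) → x ≡ y
    injective {x} {y} eq = begin
      x                          ≡⟨ combine-remQuot {length A} (suc r) x ⟨
      uncurry combine (split x)  ≡⟨ cong (uncurry combine) (codeAt-injective (encode-injective eq)) ⟩
      uncurry combine (split y)  ≡⟨ combine-remQuot {length A} (suc r) y ⟩
      y                          ∎
      where open ≡-Reasoning

-- Cut vectors along an ordering

-- A state follows one tuple along an ordering built from the last position down: advance x puts x
-- at position suc m. cuts s p is the position of the last point with label at most p, and 0 as long
-- as no such point has been placed.
module Process (r n : ℕ) where

  record State (m : ℕ) : Set where
    constructor state
    field
      labels : Labelling (suc (suc r)) m
      cuts   : ℕ → ℕ
  open State public

  stamp : ℕ → Maybe (Fin (suc (suc r))) → ℕ → ℕ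
  stamp m nothing  p = 0
  stamp m (just q) p = when (toℕ q ≤? p) (suc m)

  advance : ∀ {m} → Fin (suc m) → State (suc m) → State m
  advance {m} x s = state (removeAt (labels s) x) (λ p → cuts s p ⊔ stamp m (labels s x) p)

  stamp-≤ : ∀ m l p → stamp m l p ≤ suc m
  stamp-≤ m nothing  p = z≤n
  stamp-≤ m (just q) p with toℕ q ≤? p
  ... | yes _ = ≤-refl
  ... | no  _ = z≤n

  stamp-mono : ∀ m l {p p′} → p ≤ p′ → stamp m l p ≤ stamp m l p′
  stamp-mono m nothing  _ = z≤n
  stamp-mono m (just q) {p} {p′} p≤p′ with toℕ q ≤? p | toℕ q ≤? p′
  ... | yes _   | yes _    = ≤-refl
  ... | no  _   | _        = z≤n
  ... | yes q≤p | no  q≰p′ = ⊥-elim (q≰p′ (≤-trans q≤p p≤p′))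

  stamp-positive : ∀ m l p → 0 < stamp m l p → stamp m l p ≡ suc m × ∃ λ q → l ≡ just q × toℕ q ≤ p
  stamp-positive m (just q) p pos with toℕ q ≤? p
  ... | yes q≤p = refl , q , refl , q≤p

  stamp-at : ∀ m (q : Fin (suc (suc r))) → stamp m (just q) (toℕ q) ≡ suc m
  stamp-at m q with toℕ q ≤? toℕ q
  ... | yes _ = refl
  ... | no  q≰q = ⊥-elim (q≰q ≤-refl)

  stamp-below : ∀ m {q : Fin (suc (suc r))} {p} → p < toℕ q → stamp m (just q) p ≡ 0
  stamp-below m {q} {p} p<q with toℕ q ≤? p
  ... | yes q≤p = ⊥-elim (<⇒≱ p<q q≤p)
  ... | no  _   = refl

  record Invariant (m : ℕ) (s : State m) : Set where
    field
      late     : ∀ p → 0 < cuts s p → m < cuts s p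
      bounded  : ∀ p → cuts s p ≤ n
      monotone : ∀ {p p′} → p ≤ p′ → cuts s p ≤ cuts s p′
      settled  : ∀ p → 0 < cuts s p → ∀ t → Maybe.All (λ q → toℕ q ≤ p) (labels s t)

  advance-invariant : ∀ {m s x} → suc m ≤ n → Removable (labels s) x → Invariant (suc m) s →
                      Invariant m (advance x s)
  advance-invariant {m} {s} {x} m<n removable inv = record
    { late     = λ p pos → [ (λ c>0 → <-≤-trans (<-trans (n<1+n m) (late p c>0)) (m≤m⊔n _ _))
                           , (λ st>0 → ≤-trans (≤-reflexive (sym (proj₁ (stamp-positive m (labels s x) p st>0))))
                                               (m≤n⊔m (cuts s p) _))
                           ]′ (0<⊔ pos)
    ; bounded  = λ p → ⊔-lub (bounded p) (≤-trans (stamp-≤ m (labels s x) p) m<n)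
    ; monotone = λ p≤p′ → ⊔-mono-≤ (monotone p≤p′) (stamp-mono m (labels s x) p≤p′)
    ; settled  = λ p pos t → [ (λ c>0 → settled p c>0 (punchIn x t))
                             , (λ st>0 → below-stamp (proj₂ (stamp-positive m (labels s x) p st>0)) (punchIn x t))
                             ]′ (0<⊔ pos)
    }
    where
    open Invariant inv
    below-stamp : ∀ {p} → (∃ λ q → labels s x ≡ just q × toℕ q ≤ p) →
                  ∀ t → Maybe.All (λ q → toℕ q ≤ p) (labels s t)
    below-stamp (q , sx≡q , q≤p) t =
      Maybe.map (λ q′≤q → ≤-trans q′≤q q≤p) (Maybe.drop-just (subst (Maybe.All _) sx≡q removable) t)

  -- Initially the Bollobás condition provides the second alternative; once every point is placed
  -- only the first one is left, so the final cut vectors form an antichain.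
  Beats : ∀ {m} → State m → State m → Set
  Beats s s′ = Exceeds (suc r) (cuts s) (cuts s′)
             ⊎ ∃ λ t → ∃₂ λ q q′ → labels s t ≡ just q × labels s′ t ≡ just q′ × q Fin.< q′

  Separated : ∀ {m} → State m → State m → Set
  Separated s s′ = Beats s s′ × Beats s′ s

  advance-beats : ∀ {m u v x} → Removable (labels u) x → Removable (labels v) x →
                  Invariant (suc m) u → Invariant (suc m) v → Beats u v → Beats (advance x u) (advance x v)
  advance-beats {m} {u} {v} {x} _ _ inv-u _ (inj₁ (p , p<k , v<u)) =
    inj₁ (p , p<k , <-≤-trans (⊔-lub v<u stamp<u) (m≤m⊔n (cuts u p) _))
    where
    stamp<u : stamp m (labels v x) p < cuts u p
    stamp<u = ≤-<-trans (stamp-≤ m (labels v x) p) (Invariant.late inv-u p (≤-<-trans z≤n v<u))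
  advance-beats {m} {u} {v} {x} _ _ _ inv-v (inj₂ (t , q , q′ , ut , vt , q<q′)) with t Fin.≟ x
  ... | no t≢x = inj₂ (punchOut x≢t , q , q′ , trans (cong (labels u) (punchIn-punchOut x≢t)) ut
                                             , trans (cong (labels v) (punchIn-punchOut x≢t)) vt , q<q′)
    where
    x≢t : x ≢ t
    x≢t = t≢x ∘ sym
  ... | yes refl = inj₁ (toℕ q , <-≤-trans q<q′ (≤-pred (toℕ<n q′)) , v<u)
    where
    v-unset : cuts v (toℕ q) ≡ 0
    v-unset = n≤0⇒n≡0 (≮⇒≥ λ pos →
      <⇒≱ q<q′ (Maybe.drop-just (subst (Maybe.All _) vt (Invariant.settled inv-v (toℕ q) pos x))))
    v<u : cuts v (toℕ q) ⊔ stamp m (labels v x) (toℕ q) < cuts u (toℕ q) ⊔ stamp m (labels u x) (toℕ q)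
    v<u = begin-strict
      cuts v (toℕ q) ⊔ stamp m (labels v x) (toℕ q)
        ≡⟨ cong₂ _⊔_ v-unset (trans (cong (λ l → stamp m l (toℕ q)) vt) (stamp-below m q<q′)) ⟩
      0
        <⟨ z<s ⟩
      suc m
        ≡⟨ trans (cong (λ l → stamp m l (toℕ q)) ut) (stamp-at m q) ⟨
      stamp m (labels u x) (toℕ q)
        ≤⟨ m≤n⊔m (cuts u (toℕ q)) _ ⟩
      cuts u (toℕ q) ⊔ stamp m (labels u x) (toℕ q) ∎
      where open ≤-Reasoning

  survivors : ∀ {m} → Fin (suc m) → List (State (suc m)) → List (State m)
  survivors x P = List.map (advance x) (filter (λ s → removable? (labels s) x) P)

  module _ {m : ℕ} {x : Fin (suc m)} {P : List (State (suc m))} where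

    private
      removable-all : All (λ s → Removable (labels s) x) (filter (λ s → removable? (labels s) x) P)
      removable-all = All.all-filter (λ s → removable? (labels s) x) P

    survivors-invariant : suc m ≤ n → All (Invariant (suc m)) P → All (Invariant m) (survivors x P)
    survivors-invariant m<n invs = All.map⁺ (All.zipWith (λ (rem , inv) → advance-invariant m<n rem inv)
                                                         (removable-all , All.filter⁺ _ invs))

    survivors-separated : All (Invariant (suc m)) P → AllPairs Separated P → AllPairs Separated (survivors x P)
    survivors-separated invs seps = AllPairs.map⁺ (allPairs-map-All
      (λ (rem-u , inv-u) (rem-v , inv-v) (u>v , v>u) →
         advance-beats rem-u rem-v inv-u inv-v u>v , advance-beats rem-v rem-u inv-v inv-u v>u)
      (All.zip (removable-all , All.filter⁺ _ invs)) (AllPairs.filter⁺ _ seps))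

  mass : ∀ m → List (State m) → ℕ
  mass m P = ℕ.sum (List.map (orders m ∘ labels) P)

  mass-zero : (P : List (State 0)) → mass 0 P ≡ length P
  mass-zero []      = refl
  mass-zero (_ ∷ P) = cong suc (mass-zero P)

  mass-survivors-∷ : ∀ {m} x s (P : List (State (suc m))) →
                     mass m (survivors x (s ∷ P)) ≡ ordersEndingAt (labels s) x + mass m (survivors x P)
  mass-survivors-∷ x s P with removable? (labels s) x
  ... | yes _ = refl
  ... | no  _ = refl

  mass-suc : ∀ {m} (P : List (State (suc m))) → mass (suc m) P ≡ ∑[ x < suc m ] mass m (survivors x P)
  mass-suc {m} []      = sym (sum-replicate-zero (suc m))
  mass-suc {m} (s ∷ P) = begin
    orders (suc m) (labels s) + mass (suc m) P
      ≡⟨ cong (_+_ (orders (suc m) (labels s))) (mass-suc P) ⟩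
    ∑[ x < suc m ] ordersEndingAt (labels s) x + ∑[ x < suc m ] mass m (survivors x P)
      ≡⟨ ∑-distrib-+ (ordersEndingAt (labels s)) (λ x → mass m (survivors x P)) ⟨
    ∑[ x < suc m ] (ordersEndingAt (labels s) x + mass m (survivors x P))
      ≡⟨ sum-cong-≗ (λ x → sym (mass-survivors-∷ x s P)) ⟩
    ∑[ x < suc m ] mass m (survivors x (s ∷ P))
      ∎
    where open ≡-Reasoning

  mass-bound : ∀ {c B} → (∀ P → All (Invariant 0) P → AllPairs Separated P → c * length P ≤ B) →
               ∀ m → m ≤ n → (P : List (State m)) → All (Invariant m) P → AllPairs Separated P →
               c * mass m P ≤ B * m !
  mass-bound {c} {B} final zero _ P invs seps = begin
    c * mass 0 P     ≡⟨ cong (c *_) (mass-zero P) ⟩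
    c * length P     ≤⟨ final P invs seps ⟩
    B                ≡⟨ *-identityʳ B ⟨
    B * 1            ∎
    where open ≤-Reasoning
  mass-bound {c} {B} final (suc m) m<n P invs seps = begin
    c * mass (suc m) P                              ≡⟨ cong (c *_) (mass-suc P) ⟩
    c * ∑[ x < suc m ] mass m (survivors x P)       ≡⟨ *-distribˡ-sum c (λ x → mass m (survivors x P)) ⟩
    ∑[ x < suc m ] (c * mass m (survivors x P))     ≤⟨ ∑-mono-≤ (λ x → mass-bound {c} {B} final m (<⇒≤ m<n)
                                                         (survivors x P) (survivors-invariant m<n invs)
                                                         (survivors-separated invs seps)) ⟩
    ∑[ x < suc m ] (B * m !)                        ≡⟨ ∑-const (suc m) (B * m !) ⟩
    suc m * (B * m !)                               ≡⟨ *-CS.x∙yz≈y∙xz (suc m) B (m !) ⟩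
    B * suc m !                                     ∎
    where open ≤-Reasoning

  final-bound : ∀ P → All (Invariant 0) P → AllPairs Separated P → suc r * length P ≤ M n r + r * M n (pred r)
  final-bound P invs seps = begin
    suc r * length P                   ≡⟨ *-comm (suc r) (length P) ⟩
    length P * suc r                   ≡⟨ cong (_* suc r) (length-map cuts P) ⟨
    length (List.map cuts P) * suc r   ≤⟨ Coding.antichain-bound n r (List.map cuts P)
                                            (All.map⁺ (All.map admissible invs))
                                            (AllPairs.map⁺ (AllPairs.map incomparable seps)) ⟩
    M n r + r * M n (pred r)           ∎
    where
    open ≤-Reasoning
    admissible : ∀ {s} → Invariant 0 s → Coding.Admissible n r (cuts s)
    admissible inv = (λ p≤p′ _ → Invariant.monotone inv p≤p′) , (λ {p} _ → Invariant.bounded inv p)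
    exceeds : ∀ {s s′ : State 0} → Beats s s′ → Exceeds (suc r) (cuts s) (cuts s′)
    exceeds (inj₁ s>s′)     = s>s′
    exceeds (inj₂ (() , _))
    incomparable : ∀ {s s′ : State 0} → Separated s s′ → Incomparable (suc r) (cuts s) (cuts s′)
    incomparable (s>s′ , s′>s) = exceeds s>s′ , exceeds s′>s

-- Bollobás systems

module _ {m d n} (F : Family m d n) where

  label : Fin m → Labelling d n
  label i t with any? (λ p → t ∈? F i p)
  ... | yes (p , _) = just p
  ... | no  _       = nothing

  label-sound : ∀ i t {p} → label i t ≡ just p → t ∈ F i p
  label-sound i t with any? (λ p → t ∈? F i p)
  ... | yes (p , t∈p) = λ { refl → t∈p }
  ... | no  _         = λ ()

  module _ (disjoint : ∀ i p q → p ≢ q → ¬ ∃ λ t → t ∈ F i p ∩ F i q) where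

    label-complete : ∀ i t {p} → t ∈ F i p → label i t ≡ just p
    label-complete i t {p} t∈p with any? (λ p → t ∈? F i p)
    ... | no  t∉F         = ⊥-elim (t∉F (p , t∈p))
    ... | yes (q , t∈q) with q Fin.≟ p
    ...   | yes q≡p = cong just q≡p
    ...   | no  q≢p = ⊥-elim (disjoint i q p q≢p (t , x∈p∩q⁺ (t∈q , t∈p)))

    count-label : ∀ i p → count (label i) p ≡ ∣ F i p ∣
    count-label i p =
      trans (sum-cong-≗ (λ t → hit-label t (Vec.lookup (F i p) t) refl)) (sym (∣∣≡∑ (F i p)))
      where
      hit-label : ∀ t b → Vec.lookup (F i p) t ≡ b → hit p (label i t) ≡ (if b then 1 else 0)
      hit-label t true  t∈p = trans (cong (hit p) (label-complete i t (lookup⇒[]= t (F i p) t∈p))) (hit-self p)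
      hit-label t false t∉p with label i t in eq
      ... | nothing = refl
      ... | just q with q Fin.≟ p
      ...   | yes refl with () ← trans (sym ([]=⇒lookup (label-sound i t eq))) t∉p
      ...   | no  _    = refl

    multinomial⁻¹-label : ∀ i → multinomial⁻¹ (λ p → ∣ F i p ∣) ≡ (+ orders n (label i) ℚ./ n !) {{n !≢0}}
    multinomial⁻¹-label i =
      /-cong-cross (prodℕ (λ p → ∣ F i p ∣ !)) (sumℕ (λ p → ∣ F i p ∣) !) (orders n (label i)) (n !)
                   {{sumℕ (λ p → ∣ F i p ∣) !≢0}} {{n !≢0}} (begin
      prodℕ (λ p → ∣ F i p ∣ !) * n !                   ≡⟨ cong (_* n !) weight≡ ⟩
      weight (label i) * n !                             ≡⟨ orders-formula n (label i) ⟨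
      orders n (label i) * size (label i) !              ≡⟨ cong (λ s → orders n (label i) * s !) size≡ ⟨
      orders n (label i) * sumℕ (λ p → ∣ F i p ∣) !      ∎)
      where
      open ≡-Reasoning
      weight≡ : prodℕ (λ p → ∣ F i p ∣ !) ≡ weight (label i)
      weight≡ = trans (prodℕ≡product (λ p → ∣ F i p ∣ !)) (Π.sum-cong-≗ (λ p → cong _! (sym (count-label i p))))
      size≡ : sumℕ (λ p → ∣ F i p ∣) ≡ size (label i)
      size≡ = trans (sumℕ≡sum (λ p → ∣ F i p ∣)) (sum-cong-≗ (sym ∘ count-label i))

lubellSum≡orders : ∀ {m d n} (F : Family m d n) → IsBollobas F →
                   lubellSum F ≡ (+ (∑[ i < m ] orders n (label F i)) ℚ./ n !) {{n !≢0}}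
lubellSum≡orders {n = n} F (disjoint , _) =
  trans (sumℚ-cong (multinomial⁻¹-label F disjoint)) (sumℚ-/ (λ i → orders n (label F i)) (n !) {{n !≢0}})

orders-bound : ∀ r {m n} (F : Family m (suc (suc r)) n) → IsBollobas F →
               suc r * ∑[ i < m ] orders n (label F i) ≤ (M n r + r * M n (pred r)) * n !
orders-bound r {m} {n} F (disjoint , crossing) = begin
  suc r * ∑[ i < m ] orders n (label F i)  ≡⟨ cong (suc r *_) mass≡ ⟨
  suc r * mass n (tabulate initial)        ≤⟨ mass-bound {suc r} final-bound n ≤-refl (tabulate initial)
                                                (All.tabulate⁺ (λ _ → invariant))
                                                (AllPairs.tabulate⁺ λ i≢j → beats i≢j , beats (i≢j ∘ sym)) ⟩
  (M n r + r * M n (pred r)) * n !         ∎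
  where
  open ≤-Reasoning
  open Process r n

  initial : Fin m → State n
  initial i = state (label F i) (const 0)

  mass≡ : mass n (tabulate initial) ≡ ∑[ i < m ] orders n (label F i)
  mass≡ = trans (cong ℕ.sum (map-tabulate initial (orders n ∘ labels))) (sum-tabulate (λ i → orders n (label F i)))

  invariant : ∀ {i} → Invariant n (initial i)
  invariant = record { late = λ _ (); bounded = λ _ → z≤n; monotone = λ _ → z≤n; settled = λ _ () }

  beats : ∀ {i j} → i ≢ j → Beats (initial i) (initial j)
  beats {i} {j} i≢j with crossing i j i≢j
  ... | p , q , p<q , t , t∈ = inj₂ (t , p , q , label-complete F disjoint i t (proj₁ (x∈p∩q⁻ (F i p) (F j q) t∈))
                                             , label-complete F disjoint j t (proj₂ (x∈p∩q⁻ (F i p) (F j q) t∈))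
                                             , p<q)

lubell-bound : ∀ r {m n} (F : Family m (suc (suc r)) n) → IsBollobas F →
               lubellSum F ℚ.≤ + (M n r + r * M n (pred r)) ℚ./ suc r
lubell-bound r {m} {n} F bollobas =
  subst (ℚ._≤ _) (sym (lubellSum≡orders F bollobas))
    (/-mono-cross total (n !) B (suc r) {{n !≢0}}
                  (subst (_≤ B * n !) (*-comm (suc r) total) (orders-bound r F bollobas)))
  where
  total B : ℕ
  total = ∑[ i < m ] orders n (label F i)
  B     = M n r + r * M n (pred r)

M≡C : ∀ n r → M n r ≡ (n + r) C r
M≡C n       zero    = refl
M≡C zero    (suc r) = sym (nCn≡1 (suc r))
M≡C (suc n) (suc r) = begin
  M (suc n) r + M n (suc r)                ≡⟨ cong₂ _+_ (M≡C (suc n) r) (M≡C n (suc r)) ⟩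
  (suc n + r) C r + (n + suc r) C suc r    ≡⟨ cong (λ k → k C r + (n + suc r) C suc r) (sym (+-suc n r)) ⟩
  (n + suc r) C r + (n + suc r) C suc r    ≡⟨ nCk+nC[k+1]≡[n+1]C[k+1] (n + suc r) r ⟩
  suc (n + suc r) C suc r                  ∎
  where open ≡-Reasoning

M-one : ∀ n → M n 1 ≡ suc n
M-one zero    = refl
M-one (suc n) = cong suc (M-one n)

M≤pow : ∀ n r → M n r ≤ suc n ^ r
M≤pow n       zero    = ≤-refl
M≤pow zero    (suc r) = ≤-reflexive (sym (trans (*-identityˡ (1 ^ r)) (^-zeroˡ r)))
M≤pow (suc n) (suc r) = begin
  M (suc n) r + M n (suc r)                     ≤⟨ +-mono-≤ (M≤pow (suc n) r) (M≤pow n (suc r)) ⟩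
  suc (suc n) ^ r + suc n * suc n ^ r
    ≤⟨ +-monoʳ-≤ (suc (suc n) ^ r) (*-monoʳ-≤ (suc n) (^-monoˡ-≤ r (n≤1+n (suc n)))) ⟩
  suc (suc n) ^ r + suc n * suc (suc n) ^ r     ∎
  where open ≤-Reasoning

suc^≤2^*^ : ∀ n r .{{_ : NonZero n}} → suc n ^ r ≤ 2 ^ r * n ^ r
suc^≤2^*^ n zero    = ≤-refl
suc^≤2^*^ n (suc r) = begin
  suc n * suc n ^ r                 ≤⟨ *-mono-≤ suc≤double (suc^≤2^*^ n r) ⟩
  (2 * n) * (2 ^ r * n ^ r)         ≡⟨ *-CS.interchange 2 n (2 ^ r) (n ^ r) ⟩
  2 * 2 ^ r * (n * n ^ r)           ∎
  where
  open ≤-Reasoning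
  suc≤double : suc n ≤ 2 * n
  suc≤double = ≤-trans (≤-reflexive (+-comm 1 n)) (+-monoʳ-≤ n (≤-trans (>-nonZero⁻¹ n) (m≤m+n n 0)))

mainTerm≡ : ∀ n r → mainTerm n (suc (suc r)) ≡ + M n r / suc r
mainTerm≡ n r = cong (λ k → + k / suc r) (begin
  (n + suc (suc r) ∸ 2) C r   ≡⟨ cong (λ k → (k ∸ 2) C r) (trans (+-suc n (suc r)) (cong suc (+-suc n r))) ⟩
  (n + r) C r                 ≡⟨ M≡C n r ⟨
  M n r                       ∎)
  where open ≡-Reasoning

lubellSum-triples : ∀ {m n} (F : Family m 3 n) → IsBollobas F → lubellSum F ℚ.≤ + (n + 3) / 2
lubellSum-triples {n = n} F bollobas =
  ℚ.≤-trans (lubell-bound 1 F bollobas) (/-mono-cross (M n 1 + 1) 2 (n + 3) 2 (*-monoˡ-≤ 2 (begin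
    M n 1 + 1    ≡⟨ cong (_+ 1) (M-one n) ⟩
    suc n + 1    ≤⟨ s≤s (+-monoʳ-≤ n (n≤1+n 1)) ⟩
    suc (n + 2)  ≡⟨ +-suc n 2 ⟨
    n + 3        ∎)))
  where open ≤-Reasoning

lubellSum-pairs : ∀ {m n} (F : Family m 2 n) → IsBollobas F → lubellSum F ℚ.≤ mainTerm n 2 ℚ.+ ℚ.0ℚ ℚ.* powd-3 n 2
lubellSum-pairs {n = n} F bollobas =
  subst (lubellSum F ℚ.≤_) (sym (trans (cong (mainTerm n 2 ℚ.+_) (ℚ.*-zeroˡ (powd-3 n 2)))
                                       (trans (ℚ.+-identityʳ (mainTerm n 2)) (mainTerm≡ n 0))))
        (lubell-bound 0 F bollobas)

error-term-bound : ∀ n′ r → let n = suc n′ in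
                   + (suc r * M n r) / suc (suc r) ℚ.≤ (+ 2 ^ r / 1) ℚ.* powd-3 n (3 + r)
error-term-bound n′ r = begin
  + (suc r * M n r) / suc (suc r)        ≤⟨ /-mono-cross (suc r * M n r) (suc (suc r)) (2 ^ r * n ^ r) 1 arith ⟩
  + (2 ^ r * n ^ r) / 1                  ≡⟨ /-distrib-* (2 ^ r) 1 (n ^ r) 1 ⟩
  (+ 2 ^ r / 1) ℚ.* (+ n ^ r / 1)        ≡⟨ cong ((+ 2 ^ r / 1) ℚ.*_) powd-3≡ ⟨
  (+ 2 ^ r / 1) ℚ.* powd-3 n (3 + r)     ∎
  where
  open ℚ.≤-Reasoning
  n : ℕ
  n = suc n′
  powd-3≡ : powd-3 n (3 + r) ≡ + n ^ r / 1
  powd-3≡ = /-cong-cross (n ^ r) (n ^ (0 ∸ r)) (n ^ r) 1 {{m^n≢0 n (0 ∸ r)}}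
                         (cong (λ z → n ^ r * n ^ z) (sym (0∸n≡0 r)))
  arith : suc r * M n r * 1 ≤ 2 ^ r * n ^ r * suc (suc r)
  arith = ≤-trans (≤-reflexive (*-identityʳ _))
            (≤-trans (*-mono-≤ (n≤1+n (suc r)) (≤-trans (M≤pow n r) (suc^≤2^*^ n r)))
                     (≤-reflexive (*-comm (suc (suc r)) (2 ^ r * n ^ r))))

lubellSum-asymptotic : ∀ r {m n′} → let n = suc n′ in (F : Family m (3 + r) n) → IsBollobas F →
                       lubellSum F ℚ.≤ mainTerm n (3 + r) ℚ.+ (+ 2 ^ r / 1) ℚ.* powd-3 n (3 + r)
lubellSum-asymptotic r {n′ = n′} F bollobas = begin
  lubellSum F
    ≤⟨ lubell-bound (suc r) F bollobas ⟩
  + (M n (suc r) + suc r * M n r) / suc (suc r)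
    ≡⟨ /-distrib-+ (M n (suc r)) (suc r * M n r) (suc (suc r)) ⟩
  + M n (suc r) / suc (suc r) ℚ.+ + (suc r * M n r) / suc (suc r)
    ≤⟨ ℚ.+-mono-≤ (ℚ.≤-reflexive (sym (mainTerm≡ n (suc r)))) (error-term-bound n′ r) ⟩
  mainTerm n (3 + r) ℚ.+ (+ 2 ^ r / 1) ℚ.* powd-3 n (3 + r) ∎
  where
  open ℚ.≤-Reasoning
  n : ℕ
  n = suc n′

theorem1p6 : ((n m : ℕ) → n ≥ 1 → (F : Family m 3 n) → IsBollobas F →
    lubellSum F ℚ.≤ (+ (n + 3)) / 2)
    ×
    ((d : ℕ) → d ≥ 2 →
    Σ ℚ λ C → Σ ℕ λ N →
    (n : ℕ) → n ≥ N → n ≥ 1 → (m : ℕ) → (F : Family m d n) → IsBollobas F →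
    lubellSum F ℚ.≤ mainTerm n d ℚ.+ C ℚ.* powd-3 n d)
theorem1p6 = (λ n m _ → lubellSum-triples) , asymptotic
  where
  asymptotic : (d : ℕ) → d ≥ 2 → Σ ℚ λ C → Σ ℕ λ N → (n : ℕ) → n ≥ N → n ≥ 1 → (m : ℕ) → (F : Family m d n) →
               IsBollobas F → lubellSum F ℚ.≤ mainTerm n d ℚ.+ C ℚ.* powd-3 n d
  asymptotic (suc zero)          (s≤s ())
  asymptotic (suc (suc zero))    _ = ℚ.0ℚ , 0 , λ _ _ _ _ → lubellSum-pairs
  asymptotic (suc (suc (suc r))) _ = + 2 ^ r / 1 , 0 , λ { (suc _) _ _ _ → lubellSum-asymptotic r }
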